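{- Let $\mathcal L$ be a cubic algebra. If its enveloping algebra $\operatorname{env}(\mathcal L)$ is isomorphic to a filter algebra, then $\mathcal L$ has a g-cover.
   Context: A cubic algebra is a join-semilattice $\mathcal L$ with top $\mathbf 1$ and a binary operation $\Delta$ such that: if $x\le y$ then $\Delta(y,x)\vee x=y$; if $x\le y\le z$ then $\Delta(z,\Delta(y,x))=\Delta(\Delta(z,y),\Delta(z,x))$; if $x\le y$ then $\Delta(y,\Delta(y,x))=x$; if $x\le y\le z$ then $\Delta(z,x)\le\Delta(z,y)$; and with $xy:=\Delta(\mathbf 1,\Delta(x\vee y,y))\vee y$ one has $(xy)y=x\vee y$ and $x(yz)=y(xz)$. Cubic homomorphisms preserve $\vee,\mathbf 1,\Delta$. An MR-algebra is a cubic algebra such that whenever $a,b<x$: $\Delta(x,a)\vee b<x$ iff $a\wedge b$ does not exist. The enveloping algebra of $\mathcal L$ is an MR-algebra $\operatorname{env}(\mathcal L)$ with an embedding $e\colon\mathcal L\to\operatorname{env}(\mathcal L)$ whose range generates $\operatorname{env}(\mathcal L)$ and is an upwards-closed subalgebra, such that every cubic homomorphism from $\mathcal L$ into an MR-algebra lifts uniquely to $\operatorname{env}(\mathcal L)$. With $xy$, $\mathcal L$ is an implication algebra; an implication subalgebra is a subset closed under it. $a\sim b$ iff $\Delta(a\vee b,a)=b$; $\mathcal L/\!\sim$ is an implication algebra with $[a]\le[b]$ iff $\Delta(a\vee b,a)\le b$, $[a]\vee[b]=[a\vee\Delta(a\vee b,b)]$, $[a]\to[b]=[\Delta(a\vee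 b,a)\,b]$. A g-cover is an upwards-closed implication subalgebra $J$ such that the restriction to $J$ of the quotient map $\mathcal L\to\mathcal L/\!\sim$ is an isomorphism. For an implication algebra $\mathcal I$ (a join-semilattice with top in which every $[a,\mathbf 1]$ is Boolean, $x\to y$ being the complement of $x\vee y$ in $[y,\mathbf 1]$), $\mathsf I(\mathcal I)=\{\langle a,b\rangle: a\vee b=\mathbf 1,\ a\wedge b\text{ exists}\}$ with componentwise order and join, top $\langle\mathbf 1,\mathbf 1\rangle$, and $\Delta(\langle a,b\rangle,\langle c,d\rangle)=\langle a\wedge(b\to d),b\wedge(a\to c)\rangle$ for $\langle c,d\rangle\le\langle a,b\rangle$. A filter algebra is a cubic algebra $\mathsf I(F)$ where $F$ is a filter of a Boolean algebra regarded as an implication algebra (equivalently, an implication algebra that is a lattice). -}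

module Defs where

open import Level using (Level; _⊔_) renaming (suc to lsuc)
open import Data.Product using (Σ; Σ-syntax; ∃; ∃-syntax; _×_; _,_; proj₁; proj₂)
open import Relation.Binary.PropositionalEquality using (_≡_; _≢_)
open import Relation.Nullary using (¬_)
open import Algebra.Lattice.Bundles using (BooleanAlgebra)

-- The join-semilattice is given algebraically (∨ associative, commutative,
-- idempotent) with x ≤ y  :⇔  x ∨ y ≡ y, and top 𝟏.  Δ is a total binary
-- operation, but only its values Δ(y,x) with x ≤ y are ever constrained /
-- used (Δ is morally a partial operation defined on comparable pairs).

record CubicAlgebra (ℓ : Level) : Set (lsuc ℓ) where
  infixr 6 _∨_
  infix 4 _≤_ _<_
  field
    Carrier : Set ℓ
    _∨_     : Carrier → Carrier → Carrier
    𝟏       : Carrier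
    Δ       : Carrier → Carrier → Carrier

  _≤_ : Carrier → Carrier → Set ℓ
  x ≤ y = x ∨ y ≡ y

  _<_ : Carrier → Carrier → Set ℓ
  x < y = x ≤ y × x ≢ y

  _·_ : Carrier → Carrier → Carrier
  x · y = Δ 𝟏 (Δ (x ∨ y) y) ∨ y

  field
    ∨-assoc : ∀ x y z → (x ∨ y) ∨ z ≡ x ∨ (y ∨ z)
    ∨-comm  : ∀ x y → x ∨ y ≡ y ∨ x
    ∨-idem  : ∀ x → x ∨ x ≡ x
    ≤-𝟏     : ∀ x → x ≤ 𝟏
    ax1 : ∀ {x y} → x ≤ y → Δ y x ∨ x ≡ y
    ax2 : ∀ {x y z} → x ≤ y → y ≤ z → Δ z (Δ y x) ≡ Δ (Δ z y) (Δ z x)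
    ax3 : ∀ {x y} → x ≤ y → Δ y (Δ y x) ≡ x
    ax4 : ∀ {x y z} → x ≤ y → y ≤ z → Δ z x ≤ Δ z y
    ax5 : ∀ x y → (x · y) · y ≡ x ∨ y
    ax6 : ∀ x y z → x · (y · z) ≡ y · (x · z)

open CubicAlgebra

MeetExists : ∀ {ℓ} (L : CubicAlgebra ℓ) → Carrier L → Carrier L → Set ℓ
MeetExists L a b =
  Σ[ m ∈ Carrier L ] (_≤_ L m a × _≤_ L m b
    × (∀ z → _≤_ L z a → _≤_ L z b → _≤_ L z m))

IsMR : ∀ {ℓ} → CubicAlgebra ℓ → Set ℓ
IsMR L = ∀ {a b x} → _<_ L a x → _<_ L b x →
  ((_<_ L (_∨_ L (Δ L x a) b) x → ¬ MeetExists L a b)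
   × (¬ MeetExists L a b → _<_ L (_∨_ L (Δ L x a) b) x))

record MRAlgebra (ℓ : Level) : Set (lsuc ℓ) where
  field
    cubic : CubicAlgebra ℓ
    isMR  : IsMR cubic

open MRAlgebra

IsCubicHom : ∀ {ℓ ℓ'} (L : CubicAlgebra ℓ) (M : CubicAlgebra ℓ') →
             (Carrier L → Carrier M) → Set (ℓ ⊔ ℓ')
IsCubicHom L M f =
  (∀ x y → f (_∨_ L x y) ≡ _∨_ M (f x) (f y))
  × (f (𝟏 L) ≡ 𝟏 M)
  × (∀ {x y} → _≤_ L x y → f (Δ L y x) ≡ Δ M (f y) (f x))

data Generated {ℓ ℓ'} (M : CubicAlgebra ℓ) (S : Carrier M → Set ℓ') :
               Carrier M → Set (ℓ ⊔ ℓ') where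
  gen-base  : ∀ {x} → S x → Generated M S x
  gen-top   : Generated M S (𝟏 M)
  gen-join  : ∀ {x y} → Generated M S x → Generated M S y →
              Generated M S (_∨_ M x y)
  gen-delta : ∀ {x y} → _≤_ M x y → Generated M S y → Generated M S x →
              Generated M S (Δ M y x)

record IsEnvelope {ℓ} (L : CubicAlgebra ℓ) (M : MRAlgebra ℓ)
                  (e : Carrier L → Carrier (cubic M)) : Set (lsuc ℓ) where
  field
    e-hom       : IsCubicHom L (cubic M) e
    e-injective : ∀ x y → e x ≡ e y → x ≡ y
    generates   : ∀ m → Generated (cubic M) (λ m' → ∃[ x ] e x ≡ m') m
    range-join  : ∀ x y → ∃[ z ] e z ≡ _∨_ (cubic M) (e x) (e y)
    range-top   : ∃[ z ] e z ≡ 𝟏 (cubic M)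
    range-delta : ∀ x y → _≤_ (cubic M) (e x) (e y) →
                  ∃[ z ] e z ≡ Δ (cubic M) (e y) (e x)
    range-up    : ∀ x m → _≤_ (cubic M) (e x) m → ∃[ y ] e y ≡ m
    lift : ∀ (N : MRAlgebra ℓ) (f : Carrier L → Carrier (cubic N)) →
           IsCubicHom L (cubic N) f →
           Σ[ g ∈ (Carrier (cubic M) → Carrier (cubic N)) ]
             (IsCubicHom (cubic M) (cubic N) g
              × (∀ x → g (e x) ≡ f x)
              × (∀ (g' : Carrier (cubic M) → Carrier (cubic N)) →
                   IsCubicHom (cubic M) (cubic N) g' →
                   (∀ x → g' (e x) ≡ f x) → ∀ m → g' m ≡ g m))

module _ {c ℓ₂} (B : BooleanAlgebra c ℓ₂) where
  open BooleanAlgebra B renaming (Carrier to A; ¬_ to ∁_; _∨_ to _⊔B_; _∧_ to _⊓B_)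

  _≤B_ : A → A → Set ℓ₂
  x ≤B y = (x ⊔B y) ≈ y

  record Filter (ℓf : Level) : Set (c ⊔ ℓ₂ ⊔ lsuc ℓf) where
    field
      _∈F_   : A → Set ℓf
      resp   : ∀ {x y} → x ≈ y → _∈F_ x → _∈F_ y
      ⊤∈     : _∈F_ ⊤
      ∧-cl   : ∀ {x y} → _∈F_ x → _∈F_ y → _∈F_ (x ⊓B y)
      up-cl  : ∀ {x y} → _∈F_ x → x ≤B y → _∈F_ y

  -- implication of F regarded as an implication algebra:
  -- x → y is the complement of x ⊔B y in [y, ⊤], i.e. ¬ x ⊔B y
  _⇒_ : A → A → A
  x ⇒ y = (∁ x) ⊔B y

  _≈²_ : A × A → A × A → Set ℓ₂
  (a , b) ≈² (c' , d) = (a ≈ c') × (b ≈ d)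

  _∨²_ : A × A → A × A → A × A
  (a , b) ∨² (c' , d) = (a ⊔B c' , b ⊔B d)

  𝟏² : A × A
  𝟏² = (⊤ , ⊤)

  Δ² : A × A → A × A → A × A
  Δ² (a , b) (c' , d) = (a ⊓B (b ⇒ d) , b ⊓B (a ⇒ c'))

  -- elements of I(F): ⟨a,b⟩ with a, b ∈ F and a ⊔B b = 𝟏
  -- (a ⊓B b always exists in F since F is closed under ∧)
  InI : ∀ {ℓf} → Filter ℓf → A × A → Set (ℓ₂ ⊔ ℓf)
  InI F (a , b) = _∈F_ a × _∈F_ b × ((a ⊔B b) ≈ ⊤)
    where open Filter F

record IsoToFilterAlgebra {ℓ c ℓ₂ ℓf} (M : CubicAlgebra ℓ)
       (B : BooleanAlgebra c ℓ₂) (F : Filter B ℓf)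
       : Set (ℓ ⊔ c ⊔ ℓ₂ ⊔ ℓf) where
  open BooleanAlgebra B using () renaming (Carrier to A)
  field
    φ        : Carrier M → A × A
    φ-in     : ∀ m → InI B F (φ m)
    φ-inj    : ∀ x y → _≈²_ B (φ x) (φ y) → x ≡ y
    φ-surj   : ∀ p → InI B F p → Σ[ m ∈ Carrier M ] _≈²_ B (φ m) p
    φ-join   : ∀ x y → _≈²_ B (φ (_∨_ M x y)) (_∨²_ B (φ x) (φ y))
    φ-top    : _≈²_ B (φ (𝟏 M)) (𝟏² B)
    φ-delta  : ∀ {x y} → _≤_ M x y → _≈²_ B (φ (Δ M y x)) (Δ² B (φ y) (φ x))

module _ {ℓ} (L : CubicAlgebra ℓ) where
  -- a ∼ b iff Δ(a ∨ b, a) = b   (L/∼ has classes [a], [a] = [b] iff a ∼ b)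
  _∼_ : Carrier L → Carrier L → Set ℓ
  a ∼ b = Δ L (_∨_ L a b) a ≡ b

  -- [a] → [b] = [Δ(a ∨ b, a) b]
  record IsGCover (J : Carrier L → Set ℓ) : Set ℓ where
    field
      up-closed   : ∀ {a b} → J a → _≤_ L a b → J b
      ·-closed    : ∀ {a b} → J a → J b → J (_·_ L a b)
      q-injective : ∀ {a b} → J a → J b → a ∼ b → a ≡ b
      q-surjective : ∀ a → Σ[ b ∈ Carrier L ] (J b × b ∼ a)
      q-hom       : ∀ {a b} → J a → J b →
                    _·_ L a b ∼ _·_ L (Δ L (_∨_ L a b) a) b

  HasGCover : Set (lsuc ℓ)
  HasGCover = Σ[ J ∈ (Carrier L → Set ℓ) ] IsGCover J

module Submission where

-- Composing the envelope embedding e : L → env(L) with the isomorphism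
-- env(L) ≅ I(F) yields a "filter embedding" ψ : L → I(F): an injective map
-- preserving ∨, 𝟏 and Δ whose range is upwards closed in I(F).

open import Defs
open import Level using () renaming (_⊔_ to _⊔ℓ_)
open import Algebra.Lattice.Bundles using (BooleanAlgebra)
open import Data.Product using (Σ-syntax; _,_; proj₁; proj₂; _×_)
open import Data.Product.Relation.Binary.Pointwise.NonDependent using (×-setoid)
open import Relation.Binary.Bundles using (Setoid)
open import Relation.Binary.PropositionalEquality as ≡ using (_≡_)
import Algebra.Lattice.Properties.BooleanAlgebra as BooleanAlgebraProperties
import Relation.Binary.Reasoning.Setoid as SetoidReasoning

module BooleanFacts {c ℓ₂} (B : BooleanAlgebra c ℓ₂) where
  open BooleanAlgebra B renaming (Carrier to A; ¬_ to ∁_; _∨_ to _⊔_; _∧_ to _⊓_)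
  open BooleanAlgebraProperties B
    using (¬⊤≈⊥; ∨-zeroʳ; ∧-identityˡ; ∧-identityʳ; ∨-identityˡ; deMorgan₂)
  open SetoidReasoning setoid

  ⊔-absorbs-⊤ : ∀ {x} y → x ≈ ⊤ → y ⊔ x ≈ ⊤
  ⊔-absorbs-⊤ y x≈⊤ = trans (∨-congˡ x≈⊤) (∨-zeroʳ y)

  ⊓-⊤-unit : ∀ {x} y → x ≈ ⊤ → x ⊓ y ≈ y
  ⊓-⊤-unit y x≈⊤ = trans (∧-congʳ x≈⊤) (∧-identityˡ y)

  ∁⊤-⊔-unit : ∀ y → ∁ ⊤ ⊔ y ≈ y
  ∁⊤-⊔-unit y = trans (∨-congʳ ¬⊤≈⊥) (∨-identityˡ y)

  ∁-⊔-absorb : ∀ x y → ∁ (x ⊔ y) ⊔ y ≈ ∁ x ⊔ y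
  ∁-⊔-absorb x y = begin
    ∁ (x ⊔ y) ⊔ y         ≈⟨ ∨-congʳ (deMorgan₂ x y) ⟩
    (∁ x ⊓ ∁ y) ⊔ y       ≈⟨ ∨-distribʳ-∧ y (∁ x) (∁ y) ⟩
    (∁ x ⊔ y) ⊓ (∁ y ⊔ y) ≈⟨ ∧-congˡ (∨-complementˡ y) ⟩
    (∁ x ⊔ y) ⊓ ⊤         ≈⟨ ∧-identityʳ _ ⟩
    ∁ x ⊔ y               ∎

  ∁-⊔-⊓-recovers : ∀ {x y} → x ⊔ y ≈ ⊤ → ∁ x ⊔ (x ⊓ y) ≈ y
  ∁-⊔-⊓-recovers {x} {y} x⊔y≈⊤ = begin
    ∁ x ⊔ (x ⊓ y)         ≈⟨ ∨-distribˡ-∧ (∁ x) x y ⟩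
    (∁ x ⊔ x) ⊓ (∁ x ⊔ y) ≈⟨ ⊓-⊤-unit _ (∨-complementˡ x) ⟩
    ∁ x ⊔ y               ≈⟨ sym (∧-identityʳ _) ⟩
    (∁ x ⊔ y) ⊓ ⊤         ≈⟨ ∧-congˡ (sym x⊔y≈⊤) ⟩
    (∁ x ⊔ y) ⊓ (x ⊔ y)   ≈⟨ sym (∨-distribʳ-∧ y (∁ x) x) ⟩
    (∁ x ⊓ x) ⊔ y         ≈⟨ ∨-congʳ (∧-complementˡ x) ⟩
    ⊥ ⊔ y                 ≈⟨ ∨-identityˡ y ⟩
    y                     ∎

  ≤-antisym : ∀ {x y} → y ≈ x ⊔ y → ∁ y ⊔ x ≈ ⊤ → x ≈ y
  ≤-antisym {x} {y} y≈x⊔y y⇒x≈⊤ = begin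
    x                     ≈⟨ sym (∧-absorbs-∨ x y) ⟩
    x ⊓ (x ⊔ y)           ≈⟨ ∧-congˡ (sym y≈x⊔y) ⟩
    x ⊓ y                 ≈⟨ ∧-comm x y ⟩
    y ⊓ x                 ≈⟨ sym (∨-identityˡ _) ⟩
    ⊥ ⊔ (y ⊓ x)           ≈⟨ ∨-congʳ (sym (∧-complementʳ y)) ⟩
    (y ⊓ ∁ y) ⊔ (y ⊓ x)   ≈⟨ sym (∧-distribˡ-∨ y (∁ y) x) ⟩
    y ⊓ (∁ y ⊔ x)         ≈⟨ ∧-congˡ y⇒x≈⊤ ⟩
    y ⊓ ⊤                 ≈⟨ ∧-identityʳ y ⟩
    y                     ∎

module Pairs {c ℓ₂} (B : BooleanAlgebra c ℓ₂) where
  open BooleanAlgebra B renaming (Carrier to A; ¬_ to ∁_; _∨_ to _⊔_; _∧_ to _⊓_)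
  open BooleanAlgebraProperties B using (∧-identityˡ; ∧-identityʳ)
  open BooleanFacts B using (∁⊤-⊔-unit)

  pairSetoid : Setoid c ℓ₂
  pairSetoid = ×-setoid setoid setoid

  open Setoid pairSetoid public
    using () renaming (_≈_ to _≈ᴾ_; refl to ≈ᴾ-refl; sym to ≈ᴾ-sym; trans to ≈ᴾ-trans)

  infixr 6 _∨ᴾ_
  _∨ᴾ_ : A × A → A × A → A × A
  _∨ᴾ_ = _∨²_ B

  Δᴾ : A × A → A × A → A × A
  Δᴾ = Δ² B

  ∨ᴾ-cong : ∀ {p p' q q'} → p ≈ᴾ p' → q ≈ᴾ q' → p ∨ᴾ q ≈ᴾ p' ∨ᴾ q'
  ∨ᴾ-cong (a , b) (c' , d) = ∨-cong a c' , ∨-cong b d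

  Δᴾ-cong : ∀ {p p' q q'} → p ≈ᴾ p' → q ≈ᴾ q' → Δᴾ p q ≈ᴾ Δᴾ p' q'
  Δᴾ-cong (a , b) (c' , d) =
    ∧-cong a (∨-cong (¬-cong b) d) , ∧-cong b (∨-cong (¬-cong a) c')

  Δᴾ-diagonal : ∀ p → Δᴾ p p ≈ᴾ p
  Δᴾ-diagonal (a , b) =
    trans (∧-congˡ (∨-complementˡ b)) (∧-identityʳ a) ,
    trans (∧-congˡ (∨-complementˡ a)) (∧-identityʳ b)

  Δᴾ-top : ∀ p → Δᴾ (𝟏² B) p ≈ᴾ (proj₂ p , proj₁ p)
  Δᴾ-top (a , b) =
    trans (∧-identityˡ _) (∁⊤-⊔-unit b) , trans (∧-identityˡ _) (∁⊤-⊔-unit a)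

  ≡⇒≈ᴾ : ∀ {p q} → p ≡ q → p ≈ᴾ q
  ≡⇒≈ᴾ ≡.refl = ≈ᴾ-refl

module CubicFacts {ℓ} (L : CubicAlgebra ℓ) where
  open CubicAlgebra L

  ≤-∨ˡ : ∀ x y → x ≤ x ∨ y
  ≤-∨ˡ x y = ≡.trans (≡.sym (∨-assoc x x y)) (≡.cong (_∨ y) (∨-idem x))

  ≤-∨ʳ : ∀ x y → y ≤ x ∨ y
  ≤-∨ʳ x y = ≡.trans (≡.cong (y ∨_) (∨-comm x y)) (≡.trans (≤-∨ˡ y x) (∨-comm y x))

record FilterEmbedding {ℓ c ℓ₂ ℓf} (L : CubicAlgebra ℓ)
       (B : BooleanAlgebra c ℓ₂) (F : Filter B ℓf) : Set (ℓ ⊔ℓ c ⊔ℓ ℓ₂ ⊔ℓ ℓf) where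
  open CubicAlgebra L
  open BooleanAlgebra B using () renaming (Carrier to A)
  open Pairs B
  field
    ψ        : Carrier → A × A
    ψ-in     : ∀ x → InI B F (ψ x)
    ψ-inj    : ∀ x y → ψ x ≈ᴾ ψ y → x ≡ y
    ψ-join   : ∀ x y → ψ (x ∨ y) ≈ᴾ ψ x ∨ᴾ ψ y
    ψ-top    : ψ 𝟏 ≈ᴾ 𝟏² B
    ψ-delta  : ∀ {x y} → x ≤ y → ψ (Δ y x) ≈ᴾ Δᴾ (ψ y) (ψ x)
    ψ-upward : ∀ x p → InI B F p → ψ x ∨ᴾ p ≈ᴾ p → Σ[ y ∈ Carrier ] ψ y ≈ᴾ p

-- An enveloping algebra isomorphic to I(F) yields a filter embedding φ ∘ e:
-- the range of e is upwards closed in env(L), and φ is an isomorphism.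
envelopeEmbedding : ∀ {ℓ c ℓ₂ ℓf} (L : CubicAlgebra ℓ) (M : MRAlgebra ℓ)
    (e : CubicAlgebra.Carrier L → CubicAlgebra.Carrier (MRAlgebra.cubic M)) →
    IsEnvelope L M e →
    (B : BooleanAlgebra c ℓ₂) (F : Filter B ℓf) →
    IsoToFilterAlgebra (MRAlgebra.cubic M) B F →
    FilterEmbedding L B F
envelopeEmbedding L M e env B F iso = record
  { ψ        = λ x → φ (e x)
  ; ψ-in     = λ x → φ-in (e x)
  ; ψ-inj    = λ x y eq → e-injective x y (φ-inj (e x) (e y) eq)
  ; ψ-join   = λ x y → ≈ᴾ-trans (≡⇒≈ᴾ (≡.cong φ (e-join x y))) (φ-join (e x) (e y))
  ; ψ-top    = ≈ᴾ-trans (≡⇒≈ᴾ (≡.cong φ e-top)) φ-top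
  ; ψ-delta  = λ x≤y → ≈ᴾ-trans (≡⇒≈ᴾ (≡.cong φ (e-delta x≤y))) (φ-delta (e-mono x≤y))
  ; ψ-upward = upward
  }
  where
  open IsEnvelope env
  open IsoToFilterAlgebra iso
  open Pairs B
  module L = CubicAlgebra L
  module M = CubicAlgebra (MRAlgebra.cubic M)

  e-join : ∀ x y → e (x L.∨ y) ≡ e x M.∨ e y
  e-join = proj₁ e-hom

  e-top : e L.𝟏 ≡ M.𝟏
  e-top = proj₁ (proj₂ e-hom)

  e-delta : ∀ {x y} → x L.≤ y → e (L.Δ y x) ≡ M.Δ (e y) (e x)
  e-delta = proj₂ (proj₂ e-hom)

  e-mono : ∀ {x y} → x L.≤ y → e x M.≤ e y
  e-mono {x} {y} x≤y = ≡.trans (≡.sym (e-join x y)) (≡.cong e x≤y)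

  -- p ∈ I(F) above φ(e x) is φ m for some m ≥ e x, and m lies in the range of e.
  upward : ∀ x p → InI B F p → φ (e x) ∨ᴾ p ≈ᴾ p →
           Σ[ y ∈ L.Carrier ] φ (e y) ≈ᴾ p
  upward x p p∈I above = y , ≈ᴾ-trans (≡⇒≈ᴾ (≡.cong φ ey≡m)) φm≈p
    where
    m : M.Carrier
    m = proj₁ (φ-surj p p∈I)
    φm≈p : φ m ≈ᴾ p
    φm≈p = proj₂ (φ-surj p p∈I)
    ex≤m : e x M.≤ m
    ex≤m = φ-inj _ _ (≈ᴾ-trans (φ-join (e x) m)
             (≈ᴾ-trans (∨ᴾ-cong ≈ᴾ-refl φm≈p) (≈ᴾ-trans above (≈ᴾ-sym φm≈p))))
    y : L.Carrier
    y = proj₁ (range-up x m ex≤m)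
    ey≡m : e y ≡ m
    ey≡m = proj₂ (range-up x m ex≤m)

module CoverFromEmbedding {ℓ c ℓ₂ ℓf} (L : CubicAlgebra ℓ)
    (B : BooleanAlgebra c ℓ₂) (F : Filter B ℓf) (emb : FilterEmbedding L B F) where

  open CubicAlgebra L using (Carrier; _∨_; 𝟏; Δ; _≤_; _·_; ≤-𝟏)
    renaming (∨-idem to ∨-idemᴸ)
  open BooleanAlgebra B renaming (Carrier to A; ¬_ to ∁_; _∨_ to _⊔_; _∧_ to _⊓_)
  open BooleanAlgebraProperties B using (∨-zeroʳ; ∨-zeroˡ; ∧-identityˡ; ∧-identityʳ; ∨-idem)
  open BooleanFacts B
  open Pairs B
  open CubicFacts L
  open FilterEmbedding emb
  open Filter F using (⊤∈)
  open SetoidReasoning setoid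

  ψ₁ ψ₂ : Carrier → A
  ψ₁ x = proj₁ (ψ x)
  ψ₂ x = proj₂ (ψ x)

  ψ-cong : ∀ {x y} → x ≡ y → ψ x ≈ᴾ ψ y
  ψ-cong eq = ≡⇒≈ᴾ (≡.cong ψ eq)

  ψ-covers : ∀ x → ψ₁ x ⊔ ψ₂ x ≈ ⊤
  ψ-covers x = proj₂ (proj₂ (ψ-in x))

  -- ⟨a, ⊤⟩ lies in I(F) above ψ x = ⟨a, b⟩, hence in the range of ψ.
  raised : ∀ x → Σ[ y ∈ Carrier ] ψ y ≈ᴾ (ψ₁ x , ⊤)
  raised x = ψ-upward x (ψ₁ x , ⊤) (proj₁ (ψ-in x) , ⊤∈ , ∨-zeroʳ _) (∨-idem _ , ∨-zeroʳ _)

  raise : Carrier → Carrier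
  raise x = proj₁ (raised x)

  ψ-raise : ∀ x → ψ (raise x) ≈ᴾ (ψ₁ x , ⊤)
  ψ-raise x = proj₂ (raised x)

  ≤-raise : ∀ x → x ≤ raise x
  ≤-raise x = ψ-inj _ _ (≈ᴾ-trans (ψ-join x (raise x))
                (≈ᴾ-trans (∨ᴾ-cong ≈ᴾ-refl (ψ-raise x))
                  (≈ᴾ-trans (∨-idem _ , ∨-zeroʳ _) (≈ᴾ-sym (ψ-raise x)))))

  -- The retraction ⟨a,b⟩ ↦ ⟨a ∧ b, ⊤⟩ onto the cover.
  retract : Carrier → Carrier
  retract x = Δ (raise x) x

  ψ-retract : ∀ x → ψ (retract x) ≈ᴾ (ψ₁ x ⊓ ψ₂ x , ⊤)
  ψ-retract x = ≈ᴾ-trans (ψ-delta (≤-raise x))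
    (≈ᴾ-trans (Δᴾ-cong (ψ-raise x) ≈ᴾ-refl)
      (∧-congˡ (∁⊤-⊔-unit _) , trans (∧-identityˡ _) (∨-complementˡ _)))

  -- The g-cover: the fixed points of the retraction, i.e. the x with
  -- ψ x = ⟨a, ⊤⟩ (stated as an equation in L to stay in universe ℓ).
  InCover : Carrier → Set ℓ
  InCover x = retract x ≡ x

  cover⇒⊤ : ∀ {x} → InCover x → ψ₂ x ≈ ⊤
  cover⇒⊤ {x} fixed = trans (sym (proj₂ (ψ-cong fixed))) (proj₂ (ψ-retract x))

  ⊤⇒cover : ∀ {x} → ψ₂ x ≈ ⊤ → InCover x
  ⊤⇒cover {x} ψ₂x≈⊤ = ψ-inj _ _ (≈ᴾ-trans (ψ-retract x)
    (trans (∧-congˡ ψ₂x≈⊤) (∧-identityʳ _) , sym ψ₂x≈⊤))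

  ψ-· : ∀ x y → ψ₂ y ≈ ⊤ → ψ (x · y) ≈ᴾ (∁ (ψ₁ x) ⊔ ψ₁ y , ⊤)
  ψ-· x y ψ₂y≈⊤ = ≈ᴾ-trans (ψ-join (Δ 𝟏 w) y)
    (≈ᴾ-trans (∨ᴾ-cong ψ-antipode ≈ᴾ-refl) (first , ⊔-absorbs-⊤ _ ψ₂y≈⊤))
    where
    w : Carrier
    w = Δ (x ∨ y) y
    ψ-w : ψ w ≈ᴾ Δᴾ (ψ x ∨ᴾ ψ y) (ψ y)
    ψ-w = ≈ᴾ-trans (ψ-delta (≤-∨ʳ x y)) (Δᴾ-cong (ψ-join x y) ≈ᴾ-refl)
    ψ-antipode : ψ (Δ 𝟏 w) ≈ᴾ (ψ₂ w , ψ₁ w)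
    ψ-antipode = ≈ᴾ-trans (ψ-delta (≤-𝟏 w)) (≈ᴾ-trans (Δᴾ-cong ψ-top ≈ᴾ-refl) (Δᴾ-top (ψ w)))
    first : ψ₂ w ⊔ ψ₁ y ≈ ∁ (ψ₁ x) ⊔ ψ₁ y
    first = begin
      ψ₂ w ⊔ ψ₁ y                                          ≈⟨ ∨-congʳ (proj₂ ψ-w) ⟩
      ((ψ₂ x ⊔ ψ₂ y) ⊓ (∁ (ψ₁ x ⊔ ψ₁ y) ⊔ ψ₁ y)) ⊔ ψ₁ y
        ≈⟨ ∨-congʳ (⊓-⊤-unit _ (⊔-absorbs-⊤ _ ψ₂y≈⊤)) ⟩
      (∁ (ψ₁ x ⊔ ψ₁ y) ⊔ ψ₁ y) ⊔ ψ₁ y                      ≈⟨ ∨-assoc _ _ _ ⟩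
      ∁ (ψ₁ x ⊔ ψ₁ y) ⊔ (ψ₁ y ⊔ ψ₁ y)                      ≈⟨ ∨-congˡ (∨-idem _) ⟩
      ∁ (ψ₁ x ⊔ ψ₁ y) ⊔ ψ₁ y                               ≈⟨ ∁-⊔-absorb _ _ ⟩
      ∁ (ψ₁ x) ⊔ ψ₁ y                                      ∎

  ψ-Δ-join : ∀ {a b} → InCover a → InCover b →
             ψ (Δ (a ∨ b) a) ≈ᴾ (ψ₁ a ⊔ ψ₁ b , ∁ (ψ₁ b) ⊔ ψ₁ a)
  ψ-Δ-join {a} {b} a∈J b∈J =
    ≈ᴾ-trans (ψ-delta (≤-∨ˡ a b)) (≈ᴾ-trans (Δᴾ-cong (ψ-join a b) ≈ᴾ-refl) (first , second))
    where
    first : (ψ₁ a ⊔ ψ₁ b) ⊓ (∁ (ψ₂ a ⊔ ψ₂ b) ⊔ ψ₂ a) ≈ ψ₁ a ⊔ ψ₁ b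
    first = trans (∧-congˡ (⊔-absorbs-⊤ _ (cover⇒⊤ a∈J))) (∧-identityʳ _)
    second : (ψ₂ a ⊔ ψ₂ b) ⊓ (∁ (ψ₁ a ⊔ ψ₁ b) ⊔ ψ₁ a) ≈ ∁ (ψ₁ b) ⊔ ψ₁ a
    second = begin
      (ψ₂ a ⊔ ψ₂ b) ⊓ (∁ (ψ₁ a ⊔ ψ₁ b) ⊔ ψ₁ a) ≈⟨ ⊓-⊤-unit _ (⊔-absorbs-⊤ _ (cover⇒⊤ b∈J)) ⟩
      ∁ (ψ₁ a ⊔ ψ₁ b) ⊔ ψ₁ a                  ≈⟨ ∨-congʳ (¬-cong (∨-comm _ _)) ⟩
      ∁ (ψ₁ b ⊔ ψ₁ a) ⊔ ψ₁ a                  ≈⟨ ∁-⊔-absorb _ _ ⟩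
      ∁ (ψ₁ b) ⊔ ψ₁ a                         ∎

  -- The cover is upwards closed since ψ₂ is monotone.
  up-closed : ∀ {a b} → InCover a → a ≤ b → InCover b
  up-closed {a} {b} a∈J a≤b = ⊤⇒cover (begin
    ψ₂ b          ≈⟨ sym (proj₂ (ψ-cong a≤b)) ⟩
    ψ₂ (a ∨ b)    ≈⟨ proj₂ (ψ-join a b) ⟩
    ψ₂ a ⊔ ψ₂ b   ≈⟨ ∨-congʳ (cover⇒⊤ a∈J) ⟩
    ⊤ ⊔ ψ₂ b      ≈⟨ ∨-zeroˡ _ ⟩
    ⊤             ∎)

  ·-closed : ∀ {a b} → InCover a → InCover b → InCover (a · b)
  ·-closed {a} {b} _ b∈J = ⊤⇒cover (proj₂ (ψ-· a b (cover⇒⊤ b∈J)))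

  -- a ∼ b inside the cover gives ψ₁ a ≤ ψ₁ b and ψ₁ b → ψ₁ a = ⊤, so a = b.
  q-injective : ∀ {a b} → InCover a → InCover b → _∼_ L a b → a ≡ b
  q-injective {a} {b} a∈J b∈J a∼b =
    ψ-inj a b (≤-antisym (proj₁ ψb) (trans (sym (proj₂ ψb)) (cover⇒⊤ b∈J)) ,
               trans (cover⇒⊤ a∈J) (sym (cover⇒⊤ b∈J)))
    where
    ψb : ψ b ≈ᴾ (ψ₁ a ⊔ ψ₁ b , ∁ (ψ₁ b) ⊔ ψ₁ a)
    ψb = ≈ᴾ-trans (≈ᴾ-sym (ψ-cong a∼b)) (ψ-Δ-join a∈J b∈J)

  -- Every class [a] is represented by retract a = ⟨a₁ ∧ a₂, ⊤⟩ in the cover.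
  q-surjective : ∀ a → Σ[ b ∈ Carrier ] (InCover b × _∼_ L b a)
  q-surjective a = retract a , ⊤⇒cover (proj₂ (ψ-retract a)) , ψ-inj _ _ ψ-Δ
    where
    ψ-∨ : ψ (retract a ∨ a) ≈ᴾ (ψ₁ a , ⊤)
    ψ-∨ = ≈ᴾ-trans (ψ-join (retract a) a) (≈ᴾ-trans (∨ᴾ-cong (ψ-retract a) ≈ᴾ-refl)
            (trans (∨-comm _ _) (∨-absorbs-∧ _ _) , ∨-zeroˡ _))
    ψ-Δ : ψ (Δ (retract a ∨ a) (retract a)) ≈ᴾ ψ a
    ψ-Δ = ≈ᴾ-trans (ψ-delta (≤-∨ˡ (retract a) a))
            (≈ᴾ-trans (Δᴾ-cong ψ-∨ (ψ-retract a))
              ( trans (∧-congˡ (∨-zeroʳ _)) (∧-identityʳ _)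
              , trans (∧-identityˡ _) (∁-⊔-⊓-recovers (ψ-covers a))))

  -- ∼ is reflexive because Δ(p, p) = p in I(F).
  ∼-refl : ∀ u → _∼_ L u u
  ∼-refl u = ≡.subst (λ z → Δ z u ≡ u) (≡.sym (∨-idemᴸ u))
    (ψ-inj _ _ (≈ᴾ-trans (ψ-delta (∨-idemᴸ u)) (Δᴾ-diagonal (ψ u))))

  -- In fact a · b = Δ(a ∨ b, a) · b, since both compute to ⟨ψ₁ a → ψ₁ b, ⊤⟩.
  q-hom : ∀ {a b} → InCover a → InCover b → _∼_ L (a · b) (Δ (a ∨ b) a · b)
  q-hom {a} {b} a∈J b∈J = ≡.subst (_∼_ L (a · b)) same-product (∼-refl (a · b))
    where
    ψ₂b≈⊤ : ψ₂ b ≈ ⊤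
    ψ₂b≈⊤ = cover⇒⊤ b∈J
    d : Carrier
    d = Δ (a ∨ b) a
    ψ₁d : ∁ (ψ₁ d) ⊔ ψ₁ b ≈ ∁ (ψ₁ a) ⊔ ψ₁ b
    ψ₁d = trans (∨-congʳ (¬-cong (proj₁ (ψ-Δ-join a∈J b∈J)))) (∁-⊔-absorb _ _)
    same-product : a · b ≡ d · b
    same-product = ψ-inj _ _ (≈ᴾ-trans (ψ-· a b ψ₂b≈⊤)
      (≈ᴾ-sym (≈ᴾ-trans (ψ-· d b ψ₂b≈⊤) (ψ₁d , refl))))

  gCover : HasGCover L
  gCover = InCover , record
    { up-closed    = up-closed
    ; ·-closed     = ·-closed
    ; q-injective  = q-injective
    ; q-surjective = q-surjective
    ; q-hom        = q-hom
    }

corollary6p2 : ∀ {ℓ c ℓ₂ ℓf} (L : CubicAlgebra ℓ) (M : MRAlgebra ℓ)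
    (e : CubicAlgebra.Carrier L → CubicAlgebra.Carrier (MRAlgebra.cubic M)) →
    IsEnvelope L M e →
    (B : BooleanAlgebra c ℓ₂) (F : Filter B ℓf) →
    IsoToFilterAlgebra (MRAlgebra.cubic M) B F →
    HasGCover L
corollary6p2 L M e env B F iso =
  CoverFromEmbedding.gCover L B F (envelopeEmbedding L M e env B F iso)
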